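{- Let $\varphi=(n,r,i,j,a,b,N)$ be a valid tuple and let $\nu\in\mathcal{D}_\varphi$ be tall. The output of Algorithm 1 on input $(\varphi,\nu)$ does not depend on the choice of term made in each iteration.
   Context: $\Lambda$ is the ring of symmetric functions over $\mathbb{Z}$, with Schur basis $s_\lambda$ and Littlewood–Richardson coefficients $c^{\nu}_{\lambda,\mu}$ defined by $s_\lambda s_\mu=\sum_\nu c^\nu_{\lambda,\mu}s_\nu$. Partitions are identified with Young diagrams. $p^q$ denotes the rectangle with $q$ parts equal to $p$. $\overline{\Lambda}=\Lambda/\mathrm{Span}_\mathbb{Z}\{s_\lambda\mid\lambda\not\subseteq(n-r)^r\}$, and $\overline{s}_\lambda$ is the image of $s_\lambda$. A tuple of integers $\varphi=(n,r,i,j,a,b,N)$ is valid if all entries are $\geq 1$ and $r<n$, $a+j\leq r$, $a+i\leq n-r$, $b\leq i$, $b\leq j$, $N\leq ab$. $\mathcal{D}_\varphi$ is the set of partitions $\nu$ with: \begin{itemize} \item $i^j\subseteq\nu\subseteq (n-r)^r$; \item $|\nu|=ij+N$; \item $\nu_{j+1}\leq b$; \item at most $j+a$ parts. \end{itemize} For such $\nu$, set $\nu_B=(\nu_{j+1},\ldots,\nu_{j+a})$. Such a $\nu$ is tall if $\nu_1=i$; in this case $|\nu_B|=N$. Algorithm 1 works in the free $\mathbb{Z}$-module $F$ whose basis consists of formal symbols $\overline{s}_\lambda\otimes[\mu^{(1)},\ldots,\mu^{(k)}]$. Here $\lambda\subseteq(n-r)^r$ is a partition (possibly empty), $k\geq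 0$, and $[\mu^{(1)},\ldots,\mu^{(k)}]$ is an unordered list (multiset) of nonempty partitions contained in $(n-r)^r$. The list stands for the unexpanded product $\overline{s}_{\mu^{(1)}}\cdots\overline{s}_{\mu^{(k)}}$. On input $(\varphi,\nu)$ with $\nu$ tall, the algorithm runs as follows. \begin{enumerate} \item Initialize \[ \xi^{(0)}=\sum_{\lambda\subsetneq\nu_B}\ \sum_{\substack{\theta\subseteq(n-r)^r\\|\theta|=N-|\lambda|}}c^{\nu_B}_{\lambda,\theta}\ \overline{s}_\lambda\otimes[\theta]. \] \item While the current element $\xi^{(m-1)}$ contains, with nonzero coefficient $\gamma$, some basis symbol $\overline{s}_\lambda\otimes[\mu^{(1)},\ldots,\mu^{(k)}]$ with $|\lambda|>0$, choose one such symbol and set \[ \xi^{(m)}=\xi^{(m-1)}-\gamma\sum_{\rho,\tau\subseteq(n-r)^r}c^\lambda_{\rho,\tau}\ \overline{s}_\rho\otimes[\mu^{(1)},\ldots,\mu^{(k)},\tau], \] where $\tau$ is omitted from the list when $\tau=\emptyset$. \item When no such symbol remains, output the current element. \end{enumerate} -}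

module Defs where

open import Data.Bool using (Bool; true; false; _∧_; _∨_; not; if_then_else_)
open import Data.Nat using (ℕ; zero; suc; _+_; _*_; _∸_; _≤_; _<_; _≥_; _≤ᵇ_; _<ᵇ_; _≡ᵇ_)
open import Data.List using (List; []; _∷_; [_]; _++_; map; concatMap; filter; length; upTo; downFrom; inits; take; drop; zip)
open import Data.Nat.ListAction using (sum)
open import Data.Bool using (T?)
open import Data.Bool.ListAction using (and)
open import Data.List.Relation.Unary.All using (All)
open import Data.List.Relation.Unary.Linked using (Linked)
open import Data.Maybe using (Maybe; just; nothing)
open import Data.Product using (_×_; _,_; proj₁; proj₂; Σ)
open import Data.Integer as ℤ using (ℤ; +_)
open import Relation.Binary.PropositionalEquality using (_≡_)
open import Relation.Nullary using (¬_)
open import Relation.Unary using (Pred)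

-- Partitions are represented as weakly decreasing lists of positive
-- naturals (the empty list is the empty partition).

IsPartition : List ℕ → Set
IsPartition ν = All (0 <_) ν × Linked _≥_ ν

-- k-th part (0-indexed), 0 beyond the length
part : List ℕ → ℕ → ℕ
part []       _       = 0
part (x ∷ xs) zero    = x
part (x ∷ xs) (suc k) = part xs k

size : List ℕ → ℕ
size = sum

allᵇ : {A : Set} → (A → Bool) → List A → Bool
allᵇ p xs = and (map p xs)

eqListᵇ : List ℕ → List ℕ → Bool
eqListᵇ []       []       = true
eqListᵇ (x ∷ xs) (y ∷ ys) = (x ≡ᵇ y) ∧ eqListᵇ xs ys
eqListᵇ _        _        = false

eqListsᵇ : List (List ℕ) → List (List ℕ) → Bool
eqListsᵇ []       []       = true
eqListsᵇ (x ∷ xs) (y ∷ ys) = eqListᵇ x y ∧ eqListsᵇ xs ys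
eqListsᵇ _        _        = false

subᵇ : List ℕ → List ℕ → Bool
subᵇ λ' μ = allᵇ (λ k → part λ' k ≤ᵇ part μ k) (upTo (length λ'))

-- All partitions with at most h parts, each part ≤ m
-- (i.e. all partitions contained in the rectangle m^h).

bounded : ℕ → ℕ → List (List ℕ)
bounded zero    m = [ [] ]
bounded (suc h) m = [] ∷ concatMap (λ k → map (suc k ∷_) (bounded h (suc k))) (upTo m)

box : ℕ → ℕ → List (List ℕ)
box n r = bounded r (n ∸ r)

-- Littlewood–Richardson coefficients c^ν_{λ,μ}, computed by the
-- Littlewood–Richardson rule: number of LR tableaux of shape ν/λ and
-- content μ (semistandard skew tableaux whose reverse reading word --
-- rows top to bottom, each row right to left -- is a lattice word).

countᵇ : ℕ → List ℕ → ℕ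
countᵇ v w = length (filter (λ x → x Data.Nat.≟ v) w)

-- cells of ν/λ in reverse reading order (row, column), 0-indexed
skewCells : List ℕ → List ℕ → List (ℕ × ℕ)
skewCells λ' ν =
  concatMap (λ k → map (k ,_) (filter (λ c → part λ' k Data.Nat.≤? c) (downFrom (part ν k))))
            (upTo (length ν))

allWords : ℕ → ℕ → List (List ℕ)
allWords zero    l = [ [] ]
allWords (suc m) l = concatMap (λ v → map (suc v ∷_) (allWords m l)) (upTo l)

lookupCell : List ((ℕ × ℕ) × ℕ) → ℕ → ℕ → Maybe ℕ
lookupCell []                   r c = nothing
lookupCell (((r' , c') , v) ∷ t) r c =
  if (r' ≡ᵇ r) ∧ (c' ≡ᵇ c) then just v else lookupCell t r c

leqM : ℕ → Maybe ℕ → Bool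
leqM v nothing  = true
leqM v (just u) = v ≤ᵇ u

ltM : ℕ → Maybe ℕ → Bool
ltM v nothing  = true
ltM v (just u) = v <ᵇ u

isLR : List ℕ → List ℕ → List ℕ → List ℕ → Bool
isLR λ' μ ν w =
  contentOK ∧ latticeOK ∧ ssytOK
  where
    l = length μ
    contentOK = allᵇ (λ k → countᵇ (suc k) w ≡ᵇ part μ k) (upTo l)
    latticeOK = allᵇ (λ p → allᵇ (λ k → countᵇ (suc (suc k)) p ≤ᵇ countᵇ (suc k) p) (upTo l)) (inits w)
    tab = zip (skewCells λ' ν) w
    ssytOK = allᵇ (λ { ((r , c) , v) → leqM v (lookupCell tab r (suc c)) ∧ ltM v (lookupCell tab (suc r) c) }) tab

LR : List ℕ → List ℕ → List ℕ → ℕ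
LR ν λ' μ =
  if subᵇ λ' ν
  then length (filter (λ w → T? (isLR λ' μ ν w))
                      (allWords (length (skewCells λ' ν)) (length μ)))
  else 0

-- A basis symbol  s̄_λ ⊗ [μ¹,…,μᵏ]  is a pair
-- (λ , L) where L is the multiset of partitions, represented canonically
-- as a list sorted by lexicographic order.  An element of F is a finite
-- formal sum, given as a list of (coefficient, symbol); its value is
-- determined by the coefficient function `coeff`.

leqLex : List ℕ → List ℕ → Bool
leqLex []       _        = true
leqLex (_ ∷ _)  []       = false
leqLex (x ∷ xs) (y ∷ ys) = (x <ᵇ y) ∨ ((x ≡ᵇ y) ∧ leqLex xs ys)

insertP : List ℕ → List (List ℕ) → List (List ℕ)
insertP τ []       = [ τ ]
insertP τ (μ ∷ L) = if leqLex τ μ then τ ∷ μ ∷ L else μ ∷ insertP τ L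

-- append τ to the multiset, omitting it when τ = ∅
addPart : List ℕ → List (List ℕ) → List (List ℕ)
addPart []        L = L
addPart (t ∷ τ)   L = insertP (t ∷ τ) L

Sym : Set
Sym = List ℕ × List (List ℕ)

symEqᵇ : Sym → Sym → Bool
symEqᵇ (λ₁ , L₁) (λ₂ , L₂) = eqListᵇ λ₁ λ₂ ∧ eqListsᵇ L₁ L₂

Elem : Set
Elem = List (ℤ × Sym)

coeff : Elem → Sym → ℤ
coeff []             s = ℤ.0ℤ
coeff ((c , s') ∷ ξ) s = if symEqᵇ s' s then c ℤ.+ coeff ξ s else coeff ξ s

record Valid (n r i j a b N : ℕ) : Set where
  field
    n≥1 : 1 ≤ n
    r≥1 : 1 ≤ r
    i≥1 : 1 ≤ i
    j≥1 : 1 ≤ j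
    a≥1 : 1 ≤ a
    b≥1 : 1 ≤ b
    N≥1 : 1 ≤ N
    r<n : r < n
    a+j≤r : a + j ≤ r
    a+i≤n-r : a + i ≤ n ∸ r
    b≤i : b ≤ i
    b≤j : b ≤ j
    N≤ab : N ≤ a * b

record InD (n r i j a b N : ℕ) (ν : List ℕ) : Set where
  field
    isPart   : IsPartition ν
    rect⊆ν   : ∀ k → k < j → i ≤ part ν k
    ν⊆box-h  : length ν ≤ r
    ν⊆box-w  : ∀ k → part ν k ≤ n ∸ r
    sizeν    : size ν ≡ i * j + N
    νj+1≤b   : part ν j ≤ b
    parts≤   : length ν ≤ j + a

Tall : ℕ → List ℕ → Set
Tall i ν = part ν 0 ≡ i

nuB : ℕ → ℕ → List ℕ → List ℕ
nuB j a ν = take a (drop j ν)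

initial : ℕ → ℕ → ℕ → List ℕ → Elem
initial n r N νB =
  concatMap (λ λ' →
    if subᵇ λ' νB ∧ not (eqListᵇ λ' νB)
    then concatMap (λ θ →
           if size θ ≡ᵇ (N ∸ size λ')
           then [ (+ LR νB λ' θ , (λ' , addPart θ [])) ]
           else [])
         (box n r)
    else [])
  (box n r)

stepWith : ℕ → ℕ → Elem → Sym → Elem
stepWith n r ξ (λ' , L) =
  ξ ++ concatMap (λ ρ → map (λ τ → (ℤ.- (coeff ξ (λ' , L)) ℤ.* (+ LR λ' ρ τ) , (ρ , addPart τ L)))
                             (box n r))
                 (box n r)

Step : ℕ → ℕ → Elem → Elem → Set
Step n r ξ ξ' =
  Σ Sym λ s → (0 < size (proj₁ s)) × (¬ (coeff ξ s ≡ ℤ.0ℤ)) × (ξ' ≡ stepWith n r ξ s)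

Terminal : Elem → Set
Terminal ξ = ∀ (s : Sym) → 0 < size (proj₁ s) → coeff ξ s ≡ ℤ.0ℤ

{-# OPTIONS --safe #-}
-- For a target symbol t, define N_t(s̄_λ ⊗ L) by recursion on |λ|: it is δ_t(s̄_λ ⊗ L) when |λ| = 0,
-- and otherwise
--   N_t(s̄_λ ⊗ L) = − Σ_{|ρ| < |λ|} Σ_τ c^λ_{ρ,τ} N_t(s̄_ρ ⊗ [L, τ])      (ρ, τ ⊆ (n−r)^r);
-- extend it linearly to F. Since c^λ_{ρ,τ} vanishes unless ρ ⊆ λ, and c^λ_{λ,τ} = δ_{τ,∅}, N_t kills
-- the element Σ_{ρ,τ} c^λ_{ρ,τ} s̄_ρ ⊗ [L, τ] of which an iteration subtracts a multiple, so N_t is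
-- constant along every run. A terminal element only involves symbols with |λ| = 0, where N_t = δ_t,
-- so its coefficient at t is its value under N_t. Hence every output has coefficients N_t(ξ⁽⁰⁾).
module Submission where

open import Defs
open import Data.Nat using (ℕ)
open import Data.List using (List)
open import Relation.Binary.PropositionalEquality using (_≡_)
open import Relation.Binary.Construct.Closure.ReflexiveTransitive using (Star)

open import Data.Bool using (Bool; true; false; _∧_; not; if_then_else_; T)
open import Data.Bool.Properties using (T-∧; T-≡)
open import Data.Bool.ListAction using (and)
open import Data.Nat using (zero; suc; _<_; _≤_; _≡ᵇ_; _≤ᵇ_; _∸_; z<s; s≤s; _<?_)
import Data.Nat.Properties as ℕ
open import Data.Integer using (ℤ; 0ℤ; 1ℤ; _+_; _*_; -_)
import Data.Integer as Int
import Data.Integer.Properties as ℤ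
open import Algebra.Properties.CommutativeSemigroup ℤ.+-commutativeSemigroup using (interchange; x∙yz≈y∙xz)
open import Data.List using ([]; _∷_; _++_; map; concatMap; filter; upTo; downFrom; length; deduplicate)
import Data.List.Properties as List
open import Data.List.Membership.Propositional using (_∈_)
open import Data.List.Membership.Propositional.Properties using (∈-map⁺; ∈-map⁻; ∈-filter⁺; ∈-filter⁻; ∈-deduplicate⁺; ∈-downFrom⁻)
open import Data.List.Relation.Unary.All using (All; []; _∷_)
import Data.List.Relation.Unary.All as All
import Data.List.Relation.Unary.All.Properties as All
import Data.List.Relation.Unary.AllPairs as AllPairs
open import Data.List.Relation.Unary.AllPairs using ([]; _∷_)
import Data.List.Relation.Unary.AllPairs.Properties as AllPairs
open import Data.List.Relation.Unary.Any using (here; there)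
open import Data.List.Relation.Binary.Disjoint.Propositional using (Disjoint)
open import Data.List.Relation.Unary.Unique.Propositional using (Unique)
import Data.List.Relation.Unary.Unique.Propositional.Properties as Unique
import Data.List.Relation.Unary.Unique.DecPropositional.Properties as UniqueDec
open import Data.Product using (_,_; proj₁; proj₂; uncurry)
import Data.Product.Properties as Product
open import Data.Sum using (_⊎_; inj₁; inj₂)
open import Function using (_∘_; Equivalence)
open import Level using (0ℓ)
open import Relation.Binary.Construct.Closure.ReflexiveTransitive using (ε; _◅_)
open import Relation.Binary.Definitions using (DecidableEquality)
open import Relation.Binary.PropositionalEquality using (refl; sym; trans; cong; cong₂; subst; _≢_; ≢-sym; module ≡-Reasoning)
open import Relation.Nullary using (¬_; yes; no; _because_; does; contradiction; ¬?)
open import Relation.Nullary.Decidable using (dec-true; dec-false)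
open import Relation.Nullary.Reflects using (Reflects; ofʸ; ofⁿ; fromEquivalence; _×-reflects_)
open import Relation.Unary using (Pred; Decidable)

∑ : {A : Set} → List A → (A → ℤ) → ℤ
∑ []       g = 0ℤ
∑ (x ∷ xs) g = g x + ∑ xs g

infix 6.5 ∑
syntax ∑ xs (λ x → e) = ∑[ x ∈ xs ] e

module _ {A : Set} where

  ∑-cong-∈ : ∀ (xs : List A) {f g : A → ℤ} → (∀ {x} → x ∈ xs → f x ≡ g x) → ∑ xs f ≡ ∑ xs g
  ∑-cong-∈ []       f≗g = refl
  ∑-cong-∈ (x ∷ xs) f≗g = cong₂ _+_ (f≗g (here refl)) (∑-cong-∈ xs (λ x∈ → f≗g (there x∈)))

  ∑-cong : ∀ (xs : List A) {f g : A → ℤ} → (∀ x → f x ≡ g x) → ∑ xs f ≡ ∑ xs g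
  ∑-cong xs f≗g = ∑-cong-∈ xs (λ {x} _ → f≗g x)

  ∑-zero : ∀ (xs : List A) {g : A → ℤ} → (∀ {x} → x ∈ xs → g x ≡ 0ℤ) → ∑ xs g ≡ 0ℤ
  ∑-zero []       g≗0 = refl
  ∑-zero (x ∷ xs) g≗0 = cong₂ _+_ (g≗0 (here refl)) (∑-zero xs (λ x∈ → g≗0 (there x∈)))

  ∑-++ : ∀ (xs : List A) {ys} {g : A → ℤ} → ∑ (xs ++ ys) g ≡ ∑ xs g + ∑ ys g
  ∑-++ []       = sym (ℤ.+-identityˡ _)
  ∑-++ (x ∷ xs) {g = g} = trans (cong (g x +_) (∑-++ xs)) (sym (ℤ.+-assoc (g x) _ _))

  ∑-+ : ∀ (xs : List A) {f g : A → ℤ} → ∑[ x ∈ xs ] (f x + g x) ≡ ∑ xs f + ∑ xs g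
  ∑-+ []       = refl
  ∑-+ (x ∷ xs) {f} {g} = trans (cong (f x + g x +_) (∑-+ xs)) (interchange (f x) (g x) _ _)

  ∑-*ˡ : ∀ (xs : List A) c {f : A → ℤ} → ∑[ x ∈ xs ] (c * f x) ≡ c * ∑ xs f
  ∑-*ˡ []       c = sym (ℤ.*-zeroʳ c)
  ∑-*ˡ (x ∷ xs) c {f} = trans (cong (c * f x +_) (∑-*ˡ xs c)) (sym (ℤ.*-distribˡ-+ c (f x) _))

  ∑-partition : ∀ {P : Pred A 0ℓ} (P? : Decidable P) (xs : List A) {g : A → ℤ} →
                ∑ xs g ≡ ∑ (filter P? xs) g + ∑ (filter (¬? ∘ P?) xs) g
  ∑-partition P? []       = refl
  ∑-partition P? (x ∷ xs) {g} with does (P? x)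
  ... | true  = trans (cong (g x +_) (∑-partition P? xs)) (sym (ℤ.+-assoc (g x) _ _))
  ... | false = trans (cong (g x +_) (∑-partition P? xs)) (x∙yz≈y∙xz (g x) (∑ (filter P? xs) g) _)

  ∑-single : ∀ {xs : List A} {x} {g : A → ℤ} → Unique xs → x ∈ xs →
             (∀ {y} → y ∈ xs → y ≢ x → g y ≡ 0ℤ) → ∑ xs g ≡ g x
  ∑-single {y ∷ xs} {g = g} (y∉xs ∷ _) (here refl) g≗0 =
    trans (cong (g y +_) (∑-zero xs (λ y′∈ → g≗0 (there y′∈) (≢-sym (All.lookup y∉xs y′∈))))) (ℤ.+-identityʳ _)
  ∑-single {y ∷ xs} {g = g} (y∉xs ∷ xs!) (there x∈) g≗0 =
    trans (cong (_+ ∑ xs g) (g≗0 (here refl) (All.lookup y∉xs x∈)))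
          (trans (ℤ.+-identityˡ _) (∑-single xs! x∈ (λ y∈ → g≗0 (there y∈))))

module _ {A B : Set} where

  ∑-map : ∀ (f : A → B) (xs : List A) {g : B → ℤ} → ∑ (map f xs) g ≡ ∑[ x ∈ xs ] g (f x)
  ∑-map f []       = refl
  ∑-map f (x ∷ xs) {g} = cong (g (f x) +_) (∑-map f xs)

  ∑-concatMap : ∀ (f : A → List B) (xs : List A) {g : B → ℤ} → ∑ (concatMap f xs) g ≡ ∑[ x ∈ xs ] ∑ (f x) g
  ∑-concatMap f []       = refl
  ∑-concatMap f (x ∷ xs) {g} = trans (∑-++ (f x)) (cong (∑ (f x) g +_) (∑-concatMap f xs))

reflects-⇔ : ∀ {P Q : Set} {b} → (P → Q) → (Q → P) → Reflects P b → Reflects Q b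
reflects-⇔ P⇒Q Q⇒P (ofʸ p)  = ofʸ (P⇒Q p)
reflects-⇔ P⇒Q Q⇒P (ofⁿ ¬p) = ofⁿ (¬p ∘ Q⇒P)

eqListᵇ-reflects : ∀ xs ys → Reflects (xs ≡ ys) (eqListᵇ xs ys)
eqListᵇ-reflects []       []       = ofʸ refl
eqListᵇ-reflects []       (_ ∷ _)  = ofⁿ λ ()
eqListᵇ-reflects (_ ∷ _)  []       = ofⁿ λ ()
eqListᵇ-reflects (x ∷ xs) (y ∷ ys) =
  reflects-⇔ (uncurry (cong₂ _∷_)) List.∷-injective
    (fromEquivalence (ℕ.≡ᵇ⇒≡ x y) (ℕ.≡⇒≡ᵇ x y) ×-reflects eqListᵇ-reflects xs ys)

eqListsᵇ-reflects : ∀ xss yss → Reflects (xss ≡ yss) (eqListsᵇ xss yss)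
eqListsᵇ-reflects []         []         = ofʸ refl
eqListsᵇ-reflects []         (_ ∷ _)    = ofⁿ λ ()
eqListsᵇ-reflects (_ ∷ _)    []         = ofⁿ λ ()
eqListsᵇ-reflects (xs ∷ xss) (ys ∷ yss) =
  reflects-⇔ (uncurry (cong₂ _∷_)) List.∷-injective
    (eqListᵇ-reflects xs ys ×-reflects eqListsᵇ-reflects xss yss)

symEqᵇ-reflects : ∀ s t → Reflects (s ≡ t) (symEqᵇ s t)
symEqᵇ-reflects (λ₁ , L₁) (λ₂ , L₂) =
  reflects-⇔ (uncurry (cong₂ _,_)) Product.,-injective
    (eqListᵇ-reflects λ₁ λ₂ ×-reflects eqListsᵇ-reflects L₁ L₂)

_≟ˢ_ : DecidableEquality Sym
s ≟ˢ t = symEqᵇ s t because symEqᵇ-reflects s t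

symEqᵇ-refl : ∀ s → symEqᵇ s s ≡ true
symEqᵇ-refl s = dec-true (s ≟ˢ s) refl

symEqᵇ-≢ : ∀ {s t} → s ≢ t → symEqᵇ s t ≡ false
symEqᵇ-≢ = dec-false (_ ≟ˢ _)

δ : Sym → Sym → ℤ
δ t s = if symEqᵇ s t then 1ℤ else 0ℤ

linear : (Sym → ℤ) → Elem → ℤ
linear R ξ = ∑[ e ∈ ξ ] proj₁ e * R (proj₂ e)

coeff≡linear-δ : ∀ ξ t → coeff ξ t ≡ linear (δ t) ξ
coeff≡linear-δ []            t = refl
coeff≡linear-δ ((c , s) ∷ ξ) t with symEqᵇ s t
... | true  = cong₂ _+_ (sym (ℤ.*-identityʳ c)) (coeff≡linear-δ ξ t)
... | false = trans (sym (ℤ.+-identityˡ _)) (cong₂ _+_ (sym (ℤ.*-zeroʳ c)) (coeff≡linear-δ ξ t))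

coeff-∷-* : ∀ c s ξ t x → coeff ((c , s) ∷ ξ) t * x ≡ (if symEqᵇ s t then c * x else 0ℤ) + coeff ξ t * x
coeff-∷-* c s ξ t x with symEqᵇ s t
... | true  = ℤ.*-distribʳ-+ x c (coeff ξ t)
... | false = sym (ℤ.+-identityˡ _)

linear-in-basis : ∀ R ξ {S} → Unique S → All (λ e → proj₂ e ∈ S) ξ →
                  linear R ξ ≡ ∑[ t ∈ S ] coeff ξ t * R t
linear-in-basis R []            {S} S! []          = sym (∑-zero S (λ {t} _ → ℤ.*-zeroˡ (R t)))
linear-in-basis R ((c , s) ∷ ξ) {S} S! (s∈S ∷ ξ⊆S) = begin
  c * R s + linear R ξ
    ≡⟨ cong₂ _+_ (sym (trans (∑-single S! s∈S off-diagonal) on-diagonal)) (linear-in-basis R ξ S! ξ⊆S) ⟩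
  ∑[ t ∈ S ] (if symEqᵇ s t then c * R t else 0ℤ) + ∑[ t ∈ S ] coeff ξ t * R t
    ≡⟨ ∑-+ S ⟨
  ∑[ t ∈ S ] ((if symEqᵇ s t then c * R t else 0ℤ) + coeff ξ t * R t)
    ≡⟨ ∑-cong S (λ t → coeff-∷-* c s ξ t (R t)) ⟨
  ∑[ t ∈ S ] coeff ((c , s) ∷ ξ) t * R t ∎
  where
  open ≡-Reasoning
  on-diagonal : (if symEqᵇ s s then c * R s else 0ℤ) ≡ c * R s
  on-diagonal rewrite symEqᵇ-refl s = refl
  off-diagonal : ∀ {t} → t ∈ S → t ≢ s → (if symEqᵇ s t then c * R t else 0ℤ) ≡ 0ℤ
  off-diagonal _ t≢s rewrite symEqᵇ-≢ (≢-sym t≢s) = refl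

linear-cong-on-support : ∀ {R R′} ξ → (∀ s → R s ≡ R′ s ⊎ coeff ξ s ≡ 0ℤ) → linear R ξ ≡ linear R′ ξ
linear-cong-on-support {R} {R′} ξ agree = begin
  linear R ξ                    ≡⟨ linear-in-basis R ξ S! ξ⊆S ⟩
  ∑[ t ∈ S ] coeff ξ t * R t    ≡⟨ ∑-cong S agree-term ⟩
  ∑[ t ∈ S ] coeff ξ t * R′ t   ≡⟨ linear-in-basis R′ ξ S! ξ⊆S ⟨
  linear R′ ξ                   ∎
  where
  open ≡-Reasoning
  S = deduplicate _≟ˢ_ (map proj₂ ξ)
  S! : Unique S
  S! = UniqueDec.deduplicate-! _≟ˢ_ (map proj₂ ξ)
  ξ⊆S : All (λ e → proj₂ e ∈ S) ξ
  ξ⊆S = All.tabulate (λ e∈ξ → ∈-deduplicate⁺ _≟ˢ_ (∈-map⁺ proj₂ e∈ξ))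
  agree-term : ∀ t → coeff ξ t * R t ≡ coeff ξ t * R′ t
  agree-term t with agree t
  ... | inj₁ Rt≡R′t = cong (coeff ξ t *_) Rt≡R′t
  ... | inj₂ ξt≡0   = trans (cong (_* R t) ξt≡0) (sym (cong (_* R′ t) ξt≡0))

Positive : List ℕ → Set
Positive = All (0 <_)

block : ℕ → ℕ → List (List ℕ)
block h k = map (suc k ∷_) (bounded h (suc k))

[]∈bounded : ∀ h m → [] ∈ bounded h m
[]∈bounded zero    m = here refl
[]∈bounded (suc h) m = here refl

bounded-positive : ∀ h m → All Positive (bounded h m)
bounded-positive zero    m = [] ∷ []
bounded-positive (suc h) m = [] ∷ All.concat⁺ (All.map⁺ (All.universal block-positive (upTo m)))
  where
  block-positive : ∀ k → All Positive (block h k)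
  block-positive k = All.map⁺ (All.map (z<s ∷_) (bounded-positive h (suc k)))

bounded-unique : ∀ h m → Unique (bounded h m)
bounded-unique zero    m = [] ∷ []
bounded-unique (suc h) m =
  []∉blocks ∷ Unique.concat⁺ (All.map⁺ (All.universal block-unique (upTo m)))
                             (AllPairs.map⁺ (AllPairs.map blocks-disjoint (Unique.upTo⁺ m)))
  where
  []∉blocks : All ([] ≢_) (concatMap (block h) (upTo m))
  []∉blocks = All.concat⁺ (All.map⁺ (All.universal (λ k → All.map⁺ (All.universal (λ _ ()) _)) (upTo m)))
  block-unique : ∀ k → Unique (block h k)
  block-unique k = Unique.map⁺ List.∷-injectiveʳ (bounded-unique h (suc k))
  blocks-disjoint : ∀ {k k′} → k ≢ k′ → Disjoint (block h k) (block h k′)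
  blocks-disjoint k≢k′ (v∈k , v∈k′)
    with _ , _ , refl ← ∈-map⁻ (suc _ ∷_) v∈k
       | _ , _ , eq   ← ∈-map⁻ (suc _ ∷_) v∈k′
    = k≢k′ (ℕ.suc-injective (List.∷-injectiveˡ eq))

allᵇ-true : ∀ {A : Set} {p : A → Bool} → (∀ x → T (p x)) → ∀ xs → T (allᵇ p xs)
allᵇ-true p-true []       = _
allᵇ-true p-true (x ∷ xs) = Equivalence.from T-∧ (p-true x , allᵇ-true p-true xs)

subᵇ-refl : ∀ λ′ → subᵇ λ′ λ′ ≡ true
subᵇ-refl λ′ = Equivalence.to T-≡ (allᵇ-true (λ k → ℕ.≤⇒≤ᵇ (ℕ.≤-refl {part λ′ k})) (upTo (length λ′)))

subᵇ-∷ : ∀ x ρ y λ′ → subᵇ (x ∷ ρ) (y ∷ λ′) ≡ (x ≤ᵇ y) ∧ subᵇ ρ λ′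
subᵇ-∷ x ρ y λ′ = cong (λ bs → (x ≤ᵇ y) ∧ and bs)
  (trans (List.map-applyUpTo suc (λ k → part (x ∷ ρ) k ≤ᵇ part (y ∷ λ′) k) (length ρ))
         (sym (List.map-applyUpTo (λ k → k) (λ k → part ρ k ≤ᵇ part λ′ k) (length ρ))))

subᵇ⇒size<⊎≡ : ∀ {ρ λ′} → Positive ρ → Positive λ′ → T (subᵇ ρ λ′) → size ρ < size λ′ ⊎ ρ ≡ λ′
subᵇ⇒size<⊎≡ {[]}    {[]}     _ _ _ = inj₂ refl
subᵇ⇒size<⊎≡ {[]}    {y ∷ λ′} _ (0<y ∷ _) _ = inj₁ (ℕ.<-≤-trans 0<y (ℕ.m≤m+n y (size λ′)))
subᵇ⇒size<⊎≡ {suc x ∷ ρ} {[]} (_ ∷ _) _ ()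
subᵇ⇒size<⊎≡ {x ∷ ρ} {y ∷ λ′} (_ ∷ ρ⁺) (_ ∷ λ′⁺) ρ⊆λ′
  with x≤y , ρ⊆λ′ ← Equivalence.to T-∧ (subst T (subᵇ-∷ x ρ y λ′) ρ⊆λ′)
  with ℕ.m≤n⇒m<n∨m≡n (ℕ.≤ᵇ⇒≤ x y x≤y) | subᵇ⇒size<⊎≡ ρ⁺ λ′⁺ ρ⊆λ′
... | inj₁ x<y  | inj₁ ρ<λ′ = inj₁ (ℕ.+-mono-< x<y ρ<λ′)
... | inj₁ x<y  | inj₂ refl = inj₁ (ℕ.+-monoˡ-< (size ρ) x<y)
... | inj₂ refl | inj₁ ρ<λ′ = inj₁ (ℕ.+-monoʳ-< x ρ<λ′)
... | inj₂ refl | inj₂ refl = inj₂ refl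

LR-vanishes : ∀ {λ′ ρ} τ → Positive ρ → Positive λ′ → ¬ size ρ < size λ′ → ρ ≢ λ′ → LR λ′ ρ τ ≡ 0
LR-vanishes {λ′} {ρ} τ ρ⁺ λ′⁺ ρ≮λ′ ρ≢λ′ with subᵇ ρ λ′ in ρ⊆λ′
... | false = refl
... | true with subᵇ⇒size<⊎≡ ρ⁺ λ′⁺ (Equivalence.from T-≡ ρ⊆λ′)
...   | inj₁ ρ<λ′ = contradiction ρ<λ′ ρ≮λ′
...   | inj₂ ρ≡λ′ = contradiction ρ≡λ′ ρ≢λ′

skewCells-diag : ∀ λ′ → skewCells λ′ λ′ ≡ []
skewCells-diag λ′ = concatMap-[] (upTo (length λ′)) (λ k → cong (map (k ,_)) (no-cells k))
  where
  no-cells : ∀ k → filter (λ c → part λ′ k ℕ.≤? c) (downFrom (part λ′ k)) ≡ []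
  no-cells k = List.filter-none (λ c → part λ′ k ℕ.≤? c) (All.tabulate (λ c∈ → ℕ.<⇒≱ (∈-downFrom⁻ c∈)))
  concatMap-[] : ∀ {B : Set} {f : ℕ → List B} ks → (∀ k → f k ≡ []) → concatMap f ks ≡ []
  concatMap-[] []       _     = refl
  concatMap-[] (k ∷ ks) f≗[] rewrite f≗[] k = concatMap-[] ks f≗[]

LR-diag-[] : ∀ λ′ → LR λ′ λ′ [] ≡ 1
LR-diag-[] λ′ rewrite subᵇ-refl λ′ | skewCells-diag λ′ = refl

LR-diag-nonempty : ∀ λ′ {τ} → Positive τ → τ ≢ [] → LR λ′ λ′ τ ≡ 0
LR-diag-nonempty λ′ {[]}        _        τ≢[] = contradiction refl τ≢[]
LR-diag-nonempty λ′ {zero ∷ _}  (() ∷ _) _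
LR-diag-nonempty λ′ {suc _ ∷ _} _        _ rewrite subᵇ-refl λ′ | skewCells-diag λ′ = refl

All-if : ∀ {A : Set} {P : A → Set} b {xs} → All P xs → All P (if b then xs else [])
All-if true  Pxs = Pxs
All-if false _   = []

module _ (n r : ℕ) where

  B : List (List ℕ)
  B = box n r

  smallerThan : ℕ → List (List ℕ)
  smallerThan m = filter (λ ρ → size ρ <? m) B

  -- For s = s̄_λ ⊗ L, lrSum R s ρ is R(Σ_τ c^λ_{ρ,τ} s̄_ρ ⊗ [L, τ]); summed over ρ it is R of the
  -- element whose multiple an iteration at s subtracts.
  lrSum : (Sym → ℤ) → Sym → List ℕ → ℤ
  lrSum R (λ′ , L) ρ = ∑[ τ ∈ B ] (Int.+ LR λ′ ρ τ) * R (ρ , addPart τ L)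

  lrExpansion : (Sym → ℤ) → Sym → ℤ
  lrExpansion R s = ∑[ ρ ∈ B ] lrSum R s ρ

  -- N_t(s) of the header computed with fuel f; every f ≥ |λ| gives the same value.
  normalFormWith : ℕ → Sym → Sym → ℤ
  normalFormWith zero    t s        = δ t s
  normalFormWith (suc f) t (λ′ , L) with size λ′
  ... | zero  = δ t (λ′ , L)
  ... | suc k = - (∑[ ρ ∈ smallerThan (suc k) ] lrSum (normalFormWith f t) (λ′ , L) ρ)

  normalForm : Sym → Sym → ℤ
  normalForm t s = normalFormWith (size (proj₁ s)) t s

  normalFormWith-size0 : ∀ f t {λ′ L} → size λ′ ≡ 0 → normalFormWith f t (λ′ , L) ≡ δ t (λ′ , L)
  normalFormWith-size0 zero    t _     = refl
  normalFormWith-size0 (suc f) t λ′≡0 rewrite λ′≡0 = refl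

  lrSums-cong : ∀ {R R′} m s → (∀ ρ M → size ρ < m → R (ρ , M) ≡ R′ (ρ , M)) →
                ∑[ ρ ∈ smallerThan m ] lrSum R s ρ ≡ ∑[ ρ ∈ smallerThan m ] lrSum R′ s ρ
  lrSums-cong m (λ′ , L) R≗R′ = ∑-cong-∈ (smallerThan m) λ {ρ} ρ∈ → ∑-cong B λ τ →
    cong (Int.+ LR λ′ ρ τ *_) (R≗R′ ρ (addPart τ L) (proj₂ (∈-filter⁻ (λ ρ → size ρ <? m) {xs = B} ρ∈)))

  normalFormWith-fuel : ∀ {f g} t λ′ L → size λ′ ≤ f → size λ′ ≤ g →
                        normalFormWith f t (λ′ , L) ≡ normalFormWith g t (λ′ , L)
  normalFormWith-fuel {f} {g} t λ′ L _ _ with size λ′ in λ′≡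
  ... | zero = trans (normalFormWith-size0 f t λ′≡) (sym (normalFormWith-size0 g t λ′≡))
  normalFormWith-fuel {suc f} {suc g} t λ′ L (s≤s k≤f) (s≤s k≤g) | suc k rewrite λ′≡ =
    cong -_ (lrSums-cong (suc k) (λ′ , L) λ ρ M ρ≤k →
      normalFormWith-fuel t ρ M (ℕ.≤-trans (ℕ.≤-pred ρ≤k) k≤f) (ℕ.≤-trans (ℕ.≤-pred ρ≤k) k≤g))

  normalForm-size0 : ∀ t {λ′ L} → size λ′ ≡ 0 → normalForm t (λ′ , L) ≡ δ t (λ′ , L)
  normalForm-size0 t {λ′} = normalFormWith-size0 (size λ′) t

  normalForm-unfold : ∀ t λ′ L → 0 < size λ′ →
    normalForm t (λ′ , L) ≡ - (∑[ ρ ∈ smallerThan (size λ′) ] lrSum (normalForm t) (λ′ , L) ρ)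
  normalForm-unfold t λ′ L _ with size λ′ in λ′≡
  ... | suc k rewrite λ′≡ = cong -_ (lrSums-cong (suc k) (λ′ , L) λ ρ M ρ<k →
                  normalFormWith-fuel t ρ M (ℕ.≤-pred ρ<k) ℕ.≤-refl)

  B-unique : Unique B
  B-unique = bounded-unique r (n ∸ r)

  B-positive : All Positive B
  B-positive = bounded-positive r (n ∸ r)

  lrSum-diag : ∀ R λ′ L → lrSum R (λ′ , L) λ′ ≡ R (λ′ , L)
  lrSum-diag R λ′ L = begin
    lrSum R (λ′ , L) λ′                         ≡⟨ ∑-single B-unique ([]∈bounded r (n ∸ r)) off-diagonal ⟩
    Int.+ LR λ′ λ′ [] * R (λ′ , L)               ≡⟨ cong (λ c → Int.+ c * R (λ′ , L)) (LR-diag-[] λ′) ⟩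
    1ℤ * R (λ′ , L)                              ≡⟨ ℤ.*-identityˡ _ ⟩
    R (λ′ , L)                                   ∎
    where
    open ≡-Reasoning
    off-diagonal : ∀ {τ} → τ ∈ B → τ ≢ [] → Int.+ LR λ′ λ′ τ * R (λ′ , addPart τ L) ≡ 0ℤ
    off-diagonal {τ} τ∈B τ≢[] =
      trans (cong (λ c → Int.+ c * R (λ′ , addPart τ L)) (LR-diag-nonempty λ′ (All.lookup B-positive τ∈B) τ≢[]))
            (ℤ.*-zeroˡ (R (λ′ , addPart τ L)))

  lrExpansion-normalForm : ∀ t λ′ L → λ′ ∈ B → 0 < size λ′ → lrExpansion (normalForm t) (λ′ , L) ≡ 0ℤ
  lrExpansion-normalForm t λ′ L λ′∈B 0<λ′ = begin
    ∑[ ρ ∈ B ] lrSum N s ρ                                  ≡⟨ ∑-partition smaller? B ⟩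
    smaller-sum + ∑[ ρ ∈ notSmaller ] lrSum N s ρ           ≡⟨ cong (smaller-sum +_) not-smaller-sum ⟩
    smaller-sum + N s                                       ≡⟨ cong (smaller-sum +_) (normalForm-unfold t λ′ L 0<λ′) ⟩
    smaller-sum + - smaller-sum                             ≡⟨ ℤ.+-inverseʳ smaller-sum ⟩
    0ℤ                                                      ∎
    where
    open ≡-Reasoning
    N = normalForm t
    s = (λ′ , L)
    smaller-sum = ∑[ ρ ∈ smallerThan (size λ′) ] lrSum N s ρ
    smaller? : Decidable (λ ρ → size ρ < size λ′)
    smaller? ρ = size ρ <? size λ′
    notSmaller = filter (¬? ∘ smaller?) B
    λ′⁺ = All.lookup B-positive λ′∈B
    -- c^λ_{ρ,τ} ≠ 0 forces ρ ⊆ λ, so among the ρ with |ρ| ≥ |λ| only ρ = λ contributes.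
    not-smaller-sum : ∑[ ρ ∈ notSmaller ] lrSum N s ρ ≡ N s
    not-smaller-sum = trans (∑-single (Unique.filter⁺ (¬? ∘ smaller?) B-unique)
                                      (∈-filter⁺ (¬? ∘ smaller?) λ′∈B (ℕ.n≮n (size λ′))) off-diagonal)
                            (lrSum-diag N λ′ L)
      where
      off-diagonal : ∀ {ρ} → ρ ∈ notSmaller → ρ ≢ λ′ → lrSum N s ρ ≡ 0ℤ
      off-diagonal {ρ} ρ∈ ρ≢λ′ with ρ∈B , ρ≮λ′ ← ∈-filter⁻ (¬? ∘ smaller?) {xs = B} ρ∈ =
        ∑-zero B λ {τ} _ →
          trans (cong (λ c → Int.+ c * N (ρ , addPart τ L)) (LR-vanishes τ (All.lookup B-positive ρ∈B) λ′⁺ ρ≮λ′ ρ≢λ′))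
                (ℤ.*-zeroˡ (N (ρ , addPart τ L)))

  linear-stepWith : ∀ R ξ s → linear R (stepWith n r ξ s) ≡ linear R ξ + - coeff ξ s * lrExpansion R s
  linear-stepWith R ξ (λ′ , L) = begin
    linear R (ξ ++ added)                  ≡⟨ ∑-++ ξ ⟩
    linear R ξ + linear R added            ≡⟨ cong (linear R ξ +_) added-value ⟩
    linear R ξ + - γ * lrExpansion R s     ∎
    where
    open ≡-Reasoning
    s = (λ′ , L)
    γ = coeff ξ s
    added = concatMap (λ ρ → map (λ τ → (- γ * Int.+ LR λ′ ρ τ , (ρ , addPart τ L))) B) B
    added-value : linear R added ≡ - γ * lrExpansion R s
    added-value = begin
      linear R added
        ≡⟨ ∑-concatMap _ B ⟩
      ∑[ ρ ∈ B ] ∑ (map (λ τ → (- γ * Int.+ LR λ′ ρ τ , (ρ , addPart τ L))) B) (λ e → proj₁ e * R (proj₂ e))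
        ≡⟨ ∑-cong B (λ ρ → trans (∑-map _ B) (trans (∑-cong B (λ τ → ℤ.*-assoc (- γ) _ _)) (∑-*ˡ B (- γ)))) ⟩
      ∑[ ρ ∈ B ] (- γ * lrSum R s ρ)
        ≡⟨ ∑-*ˡ B (- γ) ⟩
      - γ * lrExpansion R s ∎

  -- Needed because an iteration at s̄_λ ⊗ L cancels that symbol only if λ lies in the box.
  Supported : Elem → Set
  Supported = All (λ e → proj₁ (proj₂ e) ∈ B)

  coeff≢0⇒∈B : ∀ {ξ s} → Supported ξ → coeff ξ s ≢ 0ℤ → proj₁ s ∈ B
  coeff≢0⇒∈B {[]}           []            ξs≢0 = contradiction refl ξs≢0
  coeff≢0⇒∈B {(c , s′) ∷ ξ} {s} (λ′∈B ∷ ξ⁺) ξs≢0 with symEqᵇ s′ s | symEqᵇ-reflects s′ s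
  ... | true  | ofʸ refl = λ′∈B
  ... | false | ofⁿ _    = coeff≢0⇒∈B ξ⁺ ξs≢0

  initial-supported : ∀ N νB → Supported (initial n r N νB)
  initial-supported N νB = All.concat⁺ (All.map⁺ (All.tabulate {xs = B} λ {λ′} λ′∈B →
    All-if (subᵇ λ′ νB ∧ not (eqListᵇ λ′ νB)) (All.concat⁺ (All.map⁺ (All.tabulate {xs = B} λ {θ} _ →
      All-if (size θ ≡ᵇ (N ∸ size λ′)) (λ′∈B ∷ []))))))

  step-supported : ∀ {ξ ξ′} → Step n r ξ ξ′ → Supported ξ → Supported ξ′
  step-supported (s , _ , _ , refl) ξ⁺ =
    All.++⁺ ξ⁺ (All.concat⁺ (All.map⁺ (All.tabulate λ ρ∈B → All.map⁺ (All.universal (λ _ → ρ∈B) B))))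

  step-preserves-normalForm : ∀ t {ξ ξ′} → Supported ξ → Step n r ξ ξ′ →
                              linear (normalForm t) ξ′ ≡ linear (normalForm t) ξ
  step-preserves-normalForm t {ξ} ξ⁺ ((λ′ , L) , 0<λ′ , ξs≢0 , refl) = begin
    linear N (stepWith n r ξ (λ′ , L))                       ≡⟨ linear-stepWith N ξ (λ′ , L) ⟩
    linear N ξ + - γ * lrExpansion N (λ′ , L)                ≡⟨ cong (λ x → linear N ξ + - γ * x) expansion≡0 ⟩
    linear N ξ + - γ * 0ℤ                                    ≡⟨ cong (linear N ξ +_) (ℤ.*-zeroʳ (- γ)) ⟩
    linear N ξ + 0ℤ                                          ≡⟨ ℤ.+-identityʳ _ ⟩
    linear N ξ                                               ∎
    where
    open ≡-Reasoning
    N = normalForm t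
    γ = coeff ξ (λ′ , L)
    expansion≡0 = lrExpansion-normalForm t λ′ L (coeff≢0⇒∈B ξ⁺ ξs≢0) 0<λ′

  run-preserves-normalForm : ∀ t {ξ ξ′} → Supported ξ → Star (Step n r) ξ ξ′ →
                             linear (normalForm t) ξ′ ≡ linear (normalForm t) ξ
  run-preserves-normalForm t ξ⁺ ε            = refl
  run-preserves-normalForm t ξ⁺ (step ◅ run) =
    trans (run-preserves-normalForm t (step-supported step ξ⁺) run) (step-preserves-normalForm t ξ⁺ step)

  terminal⇒coeff≡normalForm : ∀ {ξ} → Terminal ξ → ∀ t → coeff ξ t ≡ linear (normalForm t) ξ
  terminal⇒coeff≡normalForm {ξ} ξ-terminal t = trans (coeff≡linear-δ ξ t) (linear-cong-on-support ξ agree)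
    where
    agree : ∀ s → δ t s ≡ normalForm t s ⊎ coeff ξ s ≡ 0ℤ
    agree (λ′ , L) with size λ′ ℕ.≟ 0
    ... | yes λ′≡0 = inj₁ (sym (normalForm-size0 t {λ′} {L} λ′≡0))
    ... | no  λ′≢0 = inj₂ (ξ-terminal (λ′ , L) (ℕ.n≢0⇒n>0 λ′≢0))

  output≡normalForm : ∀ {ξ₀ ξ} → Supported ξ₀ → Star (Step n r) ξ₀ ξ → Terminal ξ →
                      ∀ t → coeff ξ t ≡ linear (normalForm t) ξ₀
  output≡normalForm {ξ = ξ} ξ₀⁺ run ξ-terminal t =
    trans (terminal⇒coeff≡normalForm {ξ} ξ-terminal t) (run-preserves-normalForm t ξ₀⁺ run)

proposition3p9 : ∀ (n r i j a b N : ℕ) (ν : List ℕ)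
    → Valid n r i j a b N → InD n r i j a b N ν → Tall i ν
    → ∀ (ξ ξ' : Elem)
    → Star (Step n r) (initial n r N (nuB j a ν)) ξ → Terminal ξ
    → Star (Step n r) (initial n r N (nuB j a ν)) ξ' → Terminal ξ'
    → ∀ (s : Sym) → coeff ξ s ≡ coeff ξ' s
proposition3p9 n r i j a b N ν _ _ _ ξ ξ' run ξ-terminal run' ξ'-terminal s =
  trans (output≡normalForm n r ξ₀⁺ run ξ-terminal s) (sym (output≡normalForm n r ξ₀⁺ run' ξ'-terminal s))
  where
  ξ₀⁺ = initial-supported n r N (nuB j a ν)
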